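{- For every integer $n\geq 2$, the friendship graph $F_n$ satisfies $$\chi_{D_L}(F_n)=\chi_D(F_n)=1+\Big\lceil\frac{1+\sqrt{8n+1}}{2}\Big\rceil.$$
   Context: The friendship graph $F_n$ ($n\geq 2$) is obtained by joining $n$ copies of the triangle $C_3$ at a common vertex $w$; it has vertices $w,v_1,\dots,v_{2n}$ and edges $wv_j$ for all $j$ and $v_{2i-1}v_{2i}$ for $1\leq i\leq n$. A vertex coloring is distinguishing if the only automorphism preserving all vertex colors is the identity. The distinguishing chromatic number $\chi_D(G)$ is the minimum $r$ such that $G$ has a proper distinguishing coloring with $r$ colors. Given a list assignment $L$ (a finite set $L(v)$ of colors for each vertex), $G$ is properly $L$-distinguishable if there is a proper distinguishing coloring $f$ with $f(v)\in L(v)$ for all $v$; $\chi_{D_L}(G)$ is the minimum $k$ such that $G$ is properly $L$-distinguishable for every list assignment with $|L(v)|=k$ for all $v$. -}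

module Defs where

open import Data.Nat using (ℕ; zero; suc; _+_; _*_; _∸_; _^_; _≤_; _<_)
open import Data.Nat.DivMod using (_/_)
open import Data.Fin using (Fin; zero; suc; toℕ)
open import Data.Fin.Permutation using (Permutation′; _⟨$⟩ʳ_)
open import Data.List using (List; length)
open import Data.List.Membership.Propositional using (_∈_)
open import Data.List.Relation.Unary.Unique.Propositional using (Unique)
open import Data.Product using (Σ; _×_; ∃)
open import Data.Unit using (⊤)
open import Data.Empty using (⊥)
open import Relation.Nullary using (¬_)
open import Relation.Binary.PropositionalEquality using (_≡_; _≢_)
open import Function.Bundles using (_⇔_)

record Graph : Set₁ where
  field
    N   : ℕ
    Adj : Fin N → Fin N → Set
open Graph public

-- Friendship graph F_n on vertices Fin (1 + 2n):
--   zero      represents the centre w,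
--   suc j     represents v_{j+1}   (j = 0 .. 2n-1).
-- Edges: w v_j for all j, and v_{2i-1} v_{2i}, i.e. (0-indexed) suc j ~ suc k
-- iff j ≠ k and ⌊j/2⌋ = ⌊k/2⌋.
FAdj : (n : ℕ) → Fin (suc (2 * n)) → Fin (suc (2 * n)) → Set
FAdj n zero    zero    = ⊥
FAdj n zero    (suc k) = ⊤
FAdj n (suc j) zero    = ⊤
FAdj n (suc j) (suc k) = (j ≢ k) × (toℕ j / 2 ≡ toℕ k / 2)

Friendship : ℕ → Graph
Friendship n = record { N = suc (2 * n) ; Adj = FAdj n }

IsAutomorphism : (G : Graph) → Permutation′ (N G) → Set
IsAutomorphism G π = ∀ u v → Adj G u v ⇔ Adj G (π ⟨$⟩ʳ u) (π ⟨$⟩ʳ v)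

IsProper : (G : Graph) {C : Set} → (Fin (N G) → C) → Set
IsProper G f = ∀ u v → Adj G u v → f u ≢ f v

IsDistinguishing : (G : Graph) {C : Set} → (Fin (N G) → C) → Set
IsDistinguishing G f =
  (π : Permutation′ (N G)) → IsAutomorphism G π →
  (∀ v → f (π ⟨$⟩ʳ v) ≡ f v) → ∀ v → π ⟨$⟩ʳ v ≡ v

ProperDistColourable : Graph → ℕ → Set
ProperDistColourable G r =
  Σ (Fin (N G) → Fin r) λ f → IsProper G f × IsDistinguishing G f

-- List assignments (colours are natural numbers); L(v) is a set, represented
-- as a duplicate-free list.
ListAssignment : Graph → Set
ListAssignment G = Fin (N G) → List ℕ

IsKAssignment : (G : Graph) → ListAssignment G → ℕ → Set
IsKAssignment G L k = ∀ v → Unique (L v) × length (L v) ≡ k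

ProperlyLDistinguishable : (G : Graph) → ListAssignment G → Set
ProperlyLDistinguishable G L =
  Σ (Fin (N G) → ℕ) λ f →
    (∀ v → f v ∈ L v) × IsProper G f × IsDistinguishing G f

ProperlyListDistColourable : Graph → ℕ → Set
ProperlyListDistColourable G k =
  (L : ListAssignment G) → IsKAssignment G L k → ProperlyLDistinguishable G L

IsMinimum : (ℕ → Set) → ℕ → Set
IsMinimum P k = P k × (∀ j → P j → k ≤ j)

ChiD≡ : Graph → ℕ → Set
ChiD≡ G r = IsMinimum (ProperDistColourable G) r

ChiDL≡ : Graph → ℕ → Set
ChiDL≡ G k = IsMinimum (ProperlyListDistColourable G) k

-- m = ⌈(1 + √(8n+1)) / 2⌉, i.e.  m - 1 < (1 + √(8n+1))/2 ≤ m, i.e.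
--   2m - 3 < √(8n+1) ≤ 2m - 1.
-- Since m ≥ 1 and √(8n+1) ≥ 0 both sides may be squared (the left
-- inequality is automatic when 2m - 3 < 0, i.e. m = 1).
IsCeilHalfOnePlusSqrt8nPlus1 : ℕ → ℕ → Set
IsCeilHalfOnePlusSqrt8nPlus1 n m =
  1 ≤ m × (8 * n + 1 ≤ (2 * m ∸ 1) ^ 2) × (2 ≤ m → (2 * m ∸ 3) ^ 2 < 8 * n + 1)

-- The centre has a colour of its own, and an automorphism of F_n can only permute the
-- triangles and swap the two leaves of a triangle. So a proper colouring is distinguishing
-- exactly when no two triangles carry the same unordered pair of leaf colours: if two did,
-- swapping those triangles would preserve colours. With r colours there are (r - 1) C 2 such
-- pairs. So χ_D(F_n) = 1 + m, where m is the least number with n ≤ m C 2, and m is the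
-- stated ceiling because (2m - 1)² = 8 (m C 2) + 1. For lists of size 1 + m, colour the
-- centre from its list, delete that colour from every other list, and choose the triangles'
-- pairs one at a time: fewer than m C 2 pairs are used so far, and two lists of at least m
-- colours always offer an unused pair of distinct colours.
module Submission where

open import Defs
open import Data.Nat
  using (ℕ; zero; suc; _+_; _*_; _∸_; _^_; _/_; _⊓_; _⊔_; _≤_; _<_; z≤n; s≤s; s≤s⁻¹; _≟_)
open import Data.Nat.Properties
  using (≤-total; ≤-trans; <⇒≤; n≤1+n; m≤m+n; <-≤-trans; ≤∧≢⇒<; <⇒≢; ≰⇒>; <⇒≱;
         <-cmp; module ≤-Reasoning; +-comm; +-suc; +-identityʳ; *-comm; *-suc; ⊓-comm; ⊔-comm;
         m≤n⇒m⊓n≡m; m≤n⇒m⊔n≡n; m≥n⇒m⊓n≡n; m≥n⇒m⊔n≡m; ⊔-lub;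
         +-mono-≤; +-monoˡ-≤; +-monoʳ-<; +-cancelˡ-≡; +-cancelˡ-<; +-cancelʳ-≤; +-cancelʳ-<;
         *-cancelˡ-≤; *-cancelˡ-<)
open import Data.Nat.Combinatorics using (_C_; nC1≡n; nCk+nC[k+1]≡[n+1]C[k+1])
open import Data.Nat.DivMod using (+-distrib-/-∣ˡ; m*n/n≡m; m<n⇒m/n≡0)
open import Data.Nat.Divisibility using (divides)
open import Data.Nat.Solver using (module +-*-Solver)
open import Data.Fin as Fin
  using (Fin; zero; suc; toℕ; fromℕ<; punchOut; cast; combine; remQuot; quotient; remainder; opposite)
open import Data.Fin.Properties
  using (toℕ-injective; toℕ<n; toℕ-fromℕ<; toℕ-cast; toℕ-combine; combine-remQuot;
         remQuot-combine; cast-involutive; opposite-involutive; suc-injective;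
         punchOut-injective; injective⇒≤)
open import Data.Fin.Permutation
  using (Permutation′; _⟨$⟩ʳ_; lift₀; remove; lift₀-remove; transpose; _∘ₚ_)
open import Data.List using (List; []; _∷_; length; filter; map; tabulate; upTo)
open import Data.List.Properties using (filter-notAll; length-map; length-tabulate; length-upTo)
open import Data.List.Membership.Propositional using (_∈_; _∉_; find)
open import Data.List.Membership.Propositional.Properties
  using (∈-filter⁺; ∈-filter⁻; ∈-map⁻; ∈-tabulate⁺; ∈-upTo⁻)
open import Data.List.Relation.Unary.Any as Any using (here; there)
open import Data.List.Relation.Unary.All as All using (All; all?)
open import Data.List.Relation.Unary.All.Properties.Core using (¬All⇒Any¬)
open import Data.List.Relation.Unary.Unique.Propositional using (Unique; []; _∷_)
import Data.List.Relation.Unary.Unique.Propositional.Properties as Unique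
open import Data.Product using (Σ-syntax; ∃-syntax; _×_; _,_; proj₁; proj₂; swap)
open import Data.Product.Properties using (,-injectiveˡ; ,-injectiveʳ; ≡-dec)
open import Data.List.Membership.DecPropositional (≡-dec _≟_ _≟_) using (_∈?_)
open import Data.Sum as Sum using (_⊎_; inj₁; inj₂; [_,_])
open import Data.Unit using (tt)
open import Function using (_∘_; id)
open import Function.Bundles using (_⇔_; mk⇔; Injection; Equivalence)
open import Function.Construct.Composition using (_⇔-∘_)
open import Function.Construct.Symmetry using (⇔-sym)
open import Function.Definitions using (Injective)
open import Function.Properties.Inverse using (↔⇒↣)
open import Level using (0ℓ)
open import Relation.Binary.Definitions using (DecidableEquality; tri<; tri≈; tri>)
open import Relation.Binary.PropositionalEquality
  using (_≡_; _≢_; refl; sym; trans; cong; cong₂; subst; subst₂; module ≡-Reasoning)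
open import Relation.Nullary using (Dec; yes; no; ¬_; ¬?; contradiction)
open import Relation.Nullary.Decidable using (_⊎-dec_)
open import Relation.Unary using (Pred; Decidable)
open import Relation.Unary.Properties using (∁?)

[1+n]C2≡n+nC2 : ∀ n → suc n C 2 ≡ n + n C 2
[1+n]C2≡n+nC2 n = begin
  suc n C 2      ≡⟨ nCk+nC[k+1]≡[n+1]C[k+1] n 1 ⟨
  n C 1 + n C 2  ≡⟨ cong (_+ n C 2) (nC1≡n n) ⟩
  n + n C 2      ∎
  where open ≡-Reasoning

C2-mono-≤ : ∀ {m n} → m ≤ n → m C 2 ≤ n C 2
C2-mono-≤ z≤n = z≤n
C2-mono-≤ (s≤s {m} {n} m≤n) rewrite [1+n]C2≡n+nC2 m | [1+n]C2≡n+nC2 n =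
  +-mono-≤ m≤n (C2-mono-≤ m≤n)

[1+2n]²≡8[1+n]C2+1 : ∀ n → (1 + 2 * n) ^ 2 ≡ 8 * (suc n C 2) + 1
[1+2n]²≡8[1+n]C2+1 zero    = refl
[1+2n]²≡8[1+n]C2+1 (suc n) = begin
  (1 + 2 * suc n) ^ 2                ≡⟨ expand n ⟩
  8 * suc n + (1 + 2 * n) ^ 2        ≡⟨ cong (8 * suc n +_) ([1+2n]²≡8[1+n]C2+1 n) ⟩
  8 * suc n + (8 * (suc n C 2) + 1)  ≡⟨ regroup (suc n) (suc n C 2) ⟩
  8 * (suc n + suc n C 2) + 1        ≡⟨ cong (λ x → 8 * x + 1) ([1+n]C2≡n+nC2 (suc n)) ⟨
  8 * (suc (suc n) C 2) + 1          ∎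
  where
  open ≡-Reasoning
  open +-*-Solver
  expand : ∀ n → (1 + 2 * suc n) ^ 2 ≡ 8 * suc n + (1 + 2 * n) ^ 2
  expand = solve 1 (λ n → (con 1 :+ con 2 :* (con 1 :+ n)) :^ 2
                          := con 8 :* (con 1 :+ n) :+ (con 1 :+ con 2 :* n) :^ 2) refl
  regroup : ∀ a b → 8 * a + (8 * b + 1) ≡ 8 * (a + b) + 1
  regroup = solve 2 (λ a b → con 8 :* a :+ (con 8 :* b :+ con 1) := con 8 :* (a :+ b) :+ con 1) refl

isCeil⇒C2-bounds : ∀ {n m} → 1 ≤ n → IsCeilHalfOnePlusSqrt8nPlus1 n m →
                   ∃[ k ] m ≡ suc k × k C 2 < n × n ≤ suc k C 2
isCeil⇒C2-bounds {m = zero}      _   (() , _)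
isCeil⇒C2-bounds {n} {m = suc k} 1≤n (_ , upper , lower) = k , refl , below k lower , above
  where
  above : n ≤ suc k C 2
  above = *-cancelˡ-≤ 8 (+-cancelʳ-≤ 1 (8 * n) _ (subst (8 * n + 1 ≤_) square upper))
    where
    square : (2 * suc k ∸ 1) ^ 2 ≡ 8 * (suc k C 2) + 1
    square = trans (cong (λ x → (x ∸ 1) ^ 2) (*-suc 2 k)) ([1+2n]²≡8[1+n]C2+1 k)
  below : ∀ j → (2 ≤ suc j → (2 * suc j ∸ 3) ^ 2 < 8 * n + 1) → j C 2 < n
  below zero    _     = 1≤n
  below (suc j) lower = *-cancelˡ-< 8 _ n (+-cancelʳ-< 1 _ (8 * n)
                          (subst (_< 8 * n + 1) square (lower (s≤s (s≤s z≤n)))))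
    where
    square : (2 * suc (suc j) ∸ 3) ^ 2 ≡ 8 * (suc j C 2) + 1
    square = trans (cong (λ x → (x ∸ 3) ^ 2) (trans (*-suc 2 (suc j)) (cong (2 +_) (*-suc 2 j))))
                   ([1+2n]²≡8[1+n]C2+1 j)

sortPair : ℕ × ℕ → ℕ × ℕ
sortPair (a , b) = a ⊓ b , a ⊔ b

sortPair-swap : ∀ p → sortPair (swap p) ≡ sortPair p
sortPair-swap (a , b) = cong₂ _,_ (⊓-comm b a) (⊔-comm b a)

sortPair-≤ : ∀ {a b} → a ≤ b → sortPair (a , b) ≡ (a , b)
sortPair-≤ a≤b = cong₂ _,_ (m≤n⇒m⊓n≡m a≤b) (m≤n⇒m⊔n≡n a≤b)

sortPair-sel : ∀ p → sortPair p ≡ p ⊎ sortPair p ≡ swap p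
sortPair-sel (a , b) with ≤-total a b
... | inj₁ a≤b = inj₁ (sortPair-≤ a≤b)
... | inj₂ b≤a = inj₂ (trans (sym (sortPair-swap (a , b))) (sortPair-≤ b≤a))

sortPair≡⇒≡⊎≡swap : ∀ {p q} → sortPair p ≡ sortPair q → p ≡ q ⊎ p ≡ swap q
sortPair≡⇒≡⊎≡swap {p} {q} eq with sortPair-sel p | sortPair-sel q
... | inj₁ sp≡p  | inj₁ sq≡q  = inj₁ (trans (sym sp≡p) (trans eq sq≡q))
... | inj₁ sp≡p  | inj₂ sq≡q′ = inj₂ (trans (sym sp≡p) (trans eq sq≡q′))
... | inj₂ sp≡p′ | inj₁ sq≡q  = inj₂ (cong swap (trans (sym sp≡p′) (trans eq sq≡q)))
... | inj₂ sp≡p′ | inj₂ sq≡q′ = inj₁ (cong swap (trans (sym sp≡p′) (trans eq sq≡q′)))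

m≢n⇒m⊓n<m⊔n : ∀ {m n} → m ≢ n → m ⊓ n < m ⊔ n
m≢n⇒m⊓n<m⊔n {m} {n} m≢n with ≤-total m n
... | inj₁ m≤n = subst₂ _<_ (sym (m≤n⇒m⊓n≡m m≤n)) (sym (m≤n⇒m⊔n≡n m≤n)) (≤∧≢⇒< m≤n m≢n)
... | inj₂ n≤m = subst₂ _<_ (sym (m≥n⇒m⊓n≡n n≤m)) (sym (m≥n⇒m⊔n≡m n≤m)) (≤∧≢⇒< n≤m (m≢n ∘ sym))

-- The pairs a < b < c are numbered by b C 2 + a without gaps, filling up exactly c C 2.
pairCode : ℕ × ℕ → ℕ
pairCode (a , b) = b C 2 + a

pairCode-< : ∀ {a b c} → a < b → b < c → pairCode (a , b) < c C 2
pairCode-< {a} {b} {c} a<b b<c = begin-strict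
  b C 2 + a  <⟨ +-monoʳ-< (b C 2) a<b ⟩
  b C 2 + b  ≡⟨ +-comm (b C 2) b ⟩
  b + b C 2  ≡⟨ [1+n]C2≡n+nC2 b ⟨
  suc b C 2  ≤⟨ C2-mono-≤ b<c ⟩
  c C 2      ∎
  where open ≤-Reasoning

pairCode-injective : ∀ {a b a′ b′} → a < b → a′ < b′ →
                     pairCode (a , b) ≡ pairCode (a′ , b′) → (a , b) ≡ (a′ , b′)
pairCode-injective {a} {b} {a′} {b′} a<b a′<b′ eq with <-cmp b b′
... | tri< b<b′ _ _ =
  contradiction eq (<⇒≢ (<-≤-trans (pairCode-< a<b b<b′) (m≤m+n (b′ C 2) a′)))
... | tri≈ _ refl _ = cong (_, b) (+-cancelˡ-≡ (b C 2) a a′ eq)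
... | tri> _ _ b′<b =
  contradiction (sym eq) (<⇒≢ (<-≤-trans (pairCode-< a′<b′ b′<b) (m≤m+n (b C 2) a)))

distinctPairs-bound : ∀ {n} k (p : Fin n → ℕ × ℕ) →
                      (∀ t → proj₁ (p t) < k × proj₂ (p t) < k × proj₁ (p t) ≢ proj₂ (p t)) →
                      Injective _≡_ _≡_ (sortPair ∘ p) → n ≤ k C 2
distinctPairs-bound {n} k p below separated = injective⇒≤ code-injective
  where
  increasing : ∀ t → proj₁ (sortPair (p t)) < proj₂ (sortPair (p t))
  increasing t = m≢n⇒m⊓n<m⊔n (proj₂ (proj₂ (below t)))
  code< : ∀ t → pairCode (sortPair (p t)) < k C 2
  code< t = pairCode-< (increasing t) (⊔-lub (proj₁ (below t)) (proj₁ (proj₂ (below t))))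
  code : Fin n → Fin (k C 2)
  code t = fromℕ< (code< t)
  code-injective : Injective _≡_ _≡_ code
  code-injective {t} {t′} eq = separated (pairCode-injective (increasing t) (increasing t′)
    (trans (sym (toℕ-fromℕ< (code< t))) (trans (cong toℕ eq) (toℕ-fromℕ< (code< t′)))))

module _ {A : Set} (_≟ₐ_ : DecidableEquality A) where

  without : A → List A → List A
  without x = filter (λ y → ¬? (y ≟ₐ x))

  ∈-without⁻ : ∀ {x y} xs → y ∈ without x xs → y ∈ xs × y ≢ x
  ∈-without⁻ {x} xs = ∈-filter⁻ (λ y → ¬? (y ≟ₐ x)) {xs = xs}

  unique-⊆⇒length-≤ : ∀ {xs ys : List A} → Unique xs → (∀ {z} → z ∈ xs → z ∈ ys) →
                      length xs ≤ length ys
  unique-⊆⇒length-≤ []                          _     = z≤n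
  unique-⊆⇒length-≤ {x ∷ xs} {ys} (x∉xs ∷ !xs) xs⊆ys = begin
    suc (length xs)              ≤⟨ s≤s (unique-⊆⇒length-≤ !xs xs⊆ys−x) ⟩
    suc (length (without x ys))  ≤⟨ filter-notAll (λ y → ¬? (y ≟ₐ x)) ys x∈ys ⟩
    length ys                    ∎
    where
    open ≤-Reasoning
    x∈ys : Any.Any (λ y → ¬ ¬ y ≡ x) ys
    x∈ys = Any.map (λ x≡y y≢x → y≢x (sym x≡y)) (xs⊆ys (here refl))
    xs⊆ys−x : ∀ {z} → z ∈ xs → z ∈ without x ys
    xs⊆ys−x z∈xs = ∈-filter⁺ _ (xs⊆ys (there z∈xs)) (All.lookup x∉xs z∈xs ∘ sym)

  length-without : ∀ x {xs} → Unique xs → length xs ≤ suc (length (without x xs))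
  length-without x {xs} !xs = unique-⊆⇒length-≤ !xs xs⊆x∷xs−x
    where
    xs⊆x∷xs−x : ∀ {z} → z ∈ xs → z ∈ x ∷ without x xs
    xs⊆x∷xs−x {z} z∈xs with z ≟ₐ x
    ... | yes z≡x = here z≡x
    ... | no  z≢x = there (∈-filter⁺ _ z∈xs z≢x)

length-filter+length-filter-∁ : ∀ {A : Set} {P : Pred A 0ℓ} (P? : Decidable P) xs →
                                length (filter P? xs) + length (filter (∁? P?) xs) ≡ length xs
length-filter+length-filter-∁ P? []       = refl
length-filter+length-filter-∁ P? (x ∷ xs) with P? x
... | yes _ = cong suc (length-filter+length-filter-∁ P? xs)
... | no  _ = trans (+-suc _ _) (cong suc (length-filter+length-filter-∁ P? xs))

DistinctAtLeast : ℕ → List ℕ → Set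
DistinctAtLeast m xs = Unique xs × m ≤ length xs

PairFrom : List ℕ → List ℕ → ℕ × ℕ → Set
PairFrom A B (a , b) = a ∈ A × b ∈ B × a ≢ b

Mentions : ℕ → ℕ × ℕ → Set
Mentions x p = proj₁ p ≡ x ⊎ proj₂ p ≡ x

mentions? : ∀ x p → Dec (Mentions x p)
mentions? x p = (proj₁ p ≟ x) ⊎-dec (proj₂ p ≟ x)

sortPair-mentions : ∀ {x} p → Mentions x (sortPair p) → Mentions x p
sortPair-mentions {x} p m with sortPair-sel p
... | inj₁ eq = subst (Mentions x) eq m
... | inj₂ eq = Sum.swap (subst (Mentions x) eq m)

mentions-sortPair : ∀ {x} p → Mentions x p → Mentions x (sortPair p)
mentions-sortPair {x} p m with sortPair-sel p
... | inj₁ eq = subst (Mentions x) (sym eq) m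
... | inj₂ eq = subst (Mentions x) (sym eq) (Sum.swap m)

sortPair-injectiveʳ : ∀ x {b b′} → sortPair (x , b) ≡ sortPair (x , b′) → b ≡ b′
sortPair-injectiveʳ x eq with sortPair≡⇒≡⊎≡swap eq
... | inj₁ eq′                 = ,-injectiveʳ eq′
... | inj₂ eq′ with refl ← eq′ = refl

length+length-unmentioned≤ : ∀ x {B} U → Unique B → All (λ b → sortPair (x , b) ∈ U) B →
                             length B + length (filter (∁? (mentions? x)) U) ≤ length U
length+length-unmentioned≤ x {B} U !B B⊆U = begin
  length B + length U−x                        ≡⟨ cong (_+ length U−x) (length-map candidate B) ⟨
  length (map candidate B) + length U−x        ≤⟨ +-monoˡ-≤ (length U−x) candidates-fit ⟩
  length (filter (mentions? x) U) + length U−x ≡⟨ length-filter+length-filter-∁ (mentions? x) U ⟩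
  length U                                     ∎
  where
  open ≤-Reasoning
  U−x : List (ℕ × ℕ)
  U−x = filter (∁? (mentions? x)) U
  candidate : ℕ → ℕ × ℕ
  candidate b = sortPair (x , b)
  candidates⊆ : ∀ {p} → p ∈ map candidate B → p ∈ filter (mentions? x) U
  candidates⊆ p∈ with ∈-map⁻ candidate p∈
  ... | b , b∈B , refl =
    ∈-filter⁺ (mentions? x) (All.lookup B⊆U b∈B) (mentions-sortPair (x , b) (inj₁ refl))
  candidates-fit : length (map candidate B) ≤ length (filter (mentions? x) U)
  candidates-fit =
    unique-⊆⇒length-≤ (≡-dec _≟_ _≟_) (Unique.map⁺ (sortPair-injectiveʳ x) !B) candidates⊆

-- Pair the head x of A with B if possible; otherwise U contains at least m pairs
-- mentioning x, and those are no obstacle once x is removed from both lists.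
avoidPair : ∀ m {A B} → DistinctAtLeast m A → DistinctAtLeast m B →
            (U : List (ℕ × ℕ)) → length U < m C 2 → ∃[ p ] PairFrom A B p × sortPair p ∉ U
avoidPair zero    _ _ _ ()
avoidPair (suc m) {[]} (_ , ()) _ _ _
avoidPair (suc m) {x ∷ A} {B} (x∉A ∷ !A , s≤s m≤|A|) (!B , 1+m≤|B|) U |U|< =
  pairWithx-or-recurse (all? (λ b → sortPair (x , b) ∈? U) B−x)
  where
  B−x : List ℕ
  B−x = without _≟_ x B
  U−x : List (ℕ × ℕ)
  U−x = filter (∁? (mentions? x)) U
  m≤|B−x| : m ≤ length B−x
  m≤|B−x| = s≤s⁻¹ (≤-trans 1+m≤|B| (length-without _≟_ x !B))
  |U−x|< : All (λ b → sortPair (x , b) ∈ U) B−x → length U−x < m C 2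
  |U−x|< B−x⊆U = +-cancelˡ-< m (length U−x) (m C 2) (begin-strict
    m + length U−x           ≤⟨ +-monoˡ-≤ _ m≤|B−x| ⟩
    length B−x + length U−x  ≤⟨ length+length-unmentioned≤ x U (Unique.filter⁺ _ !B) B−x⊆U ⟩
    length U                 <⟨ |U|< ⟩
    suc m C 2                ≡⟨ [1+n]C2≡n+nC2 m ⟩
    m + m C 2                ∎)
    where open ≤-Reasoning
  pairWithx-or-recurse : Dec (All (λ b → sortPair (x , b) ∈ U) B−x) →
                         ∃[ p ] PairFrom (x ∷ A) B p × sortPair p ∉ U
  pairWithx-or-recurse (no ¬all) with find (¬All⇒Any¬ (λ b → sortPair (x , b) ∈? U) B−x ¬all)
  ... | b , b∈B−x , ∉U with b∈B , b≢x ← ∈-without⁻ _≟_ B b∈B−x =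
    (x , b) , (here refl , b∈B , b≢x ∘ sym) , ∉U
  pairWithx-or-recurse (yes all)
    with avoidPair m (!A , m≤|A|) (Unique.filter⁺ _ !B , m≤|B−x|) U−x (|U−x|< all)
  ... | (a , b) , (a∈A , b∈B−x , a≢b) , ∉U−x
    with b∈B , b≢x ← ∈-without⁻ _≟_ B b∈B−x =
    (a , b) , (there a∈A , b∈B , a≢b) , ∉U
    where
    ∉U : sortPair (a , b) ∉ U
    ∉U ∈U = ∉U−x (∈-filter⁺ _ ∈U
                    ([ All.lookup x∉A a∈A ∘ sym , b≢x ] ∘ sortPair-mentions (a , b)))

chooseDistinctPairs : ∀ m {k} → k ≤ m C 2 → (A B : Fin k → List ℕ) →
  (∀ i → DistinctAtLeast m (A i)) → (∀ i → DistinctAtLeast m (B i)) →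
  Σ[ P ∈ (Fin k → ℕ × ℕ) ]
    (∀ i → PairFrom (A i) (B i) (P i)) × Injective _≡_ _≡_ (sortPair ∘ P)
chooseDistinctPairs m {zero}  _  A B _  _  = (λ ()) , (λ ()) , λ { {()} }
chooseDistinctPairs m {suc k} k< A B !A !B
  with chooseDistinctPairs m (<⇒≤ k<) (A ∘ suc) (B ∘ suc) (!A ∘ suc) (!B ∘ suc)
... | Q , Q-from , Q-injective
  with avoidPair m (!A zero) (!B zero) (tabulate (sortPair ∘ Q))
                 (subst (_< m C 2) (sym (length-tabulate (sortPair ∘ Q))) k<)
... | p , p-from , p∉ = P , P-from , P-injective
  where
  P : Fin (suc k) → ℕ × ℕ
  P zero    = p
  P (suc i) = Q i
  P-from : ∀ i → PairFrom (A i) (B i) (P i)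
  P-from zero    = p-from
  P-from (suc i) = Q-from i
  P-injective : Injective _≡_ _≡_ (sortPair ∘ P)
  P-injective {zero}  {zero}  _  = refl
  P-injective {zero}  {suc j} eq = contradiction (subst (_∈ _) (sym eq) (∈-tabulate⁺ j)) p∉
  P-injective {suc i} {zero}  eq = contradiction (subst (_∈ _) eq (∈-tabulate⁺ i)) p∉
  P-injective {suc i} {suc j} eq = cong suc (Q-injective eq)

pick : ℕ × ℕ → Fin 2 → ℕ
pick p zero    = proj₁ p
pick p (suc _) = proj₂ p

pick-∈ : ∀ {A : Fin 2 → List ℕ} {p} → PairFrom (A zero) (A (suc zero)) p →
         ∀ s → pick p s ∈ A s
pick-∈ (a∈ , _  , _) zero       = a∈
pick-∈ (_  , b∈ , _) (suc zero) = b∈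

pick-opposite-≢ : ∀ {p} → proj₁ p ≢ proj₂ p → ∀ s → pick p s ≢ pick p (opposite s)
pick-opposite-≢ a≢b zero       = a≢b
pick-opposite-≢ a≢b (suc zero) = a≢b ∘ sym

sortPair-pick : ∀ p s → sortPair (pick p s , pick p (opposite s)) ≡ sortPair p
sortPair-pick p zero       = refl
sortPair-pick p (suc zero) = sortPair-swap p

head∈ : ∀ {xs : List ℕ} {m} → length xs ≡ suc m → ∃[ c ] c ∈ xs
head∈ {c ∷ _} _ = c , here refl

[2*m+n]/2≡m : ∀ m {n} → n < 2 → (2 * m + n) / 2 ≡ m
[2*m+n]/2≡m m {n} n<2 = begin
  (2 * m + n) / 2    ≡⟨ +-distrib-/-∣ˡ n (divides m (*-comm 2 m)) ⟩
  2 * m / 2 + n / 2  ≡⟨ cong (_+ n / 2) (trans (cong (_/ 2) (*-comm 2 m)) (m*n/n≡m m 2)) ⟩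
  m + n / 2          ≡⟨ cong (m +_) (m<n⇒m/n≡0 n<2) ⟩
  m + 0              ≡⟨ +-identityʳ m ⟩
  m                  ∎
  where open ≡-Reasoning

opposite-≢ : ∀ (s : Fin 2) → opposite s ≢ s
opposite-≢ zero       ()
opposite-≢ (suc zero) ()

≢⇒≡opposite : ∀ {s s′ : Fin 2} → s ≢ s′ → s′ ≡ opposite s
≢⇒≡opposite {zero}     {zero}     s≢s′ = contradiction refl s≢s′
≢⇒≡opposite {zero}     {suc zero} _    = refl
≢⇒≡opposite {suc zero} {zero}     _    = refl
≢⇒≡opposite {suc zero} {suc zero} s≢s′ = contradiction refl s≢s′

module _ {m} (i j : Fin m) where

  transpose-matchˡ : transpose i j ⟨$⟩ʳ i ≡ j
  transpose-matchˡ with i Fin.≟ i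
  ... | yes _   = refl
  ... | no  i≢i = contradiction refl i≢i

  transpose-matchʳ : transpose i j ⟨$⟩ʳ j ≡ i
  transpose-matchʳ with j Fin.≟ i
  ... | yes j≡i = j≡i
  ... | no  _ with j Fin.≟ j
  ...   | yes _   = refl
  ...   | no  j≢j = contradiction refl j≢j

  transpose-other : ∀ {k} → k ≢ i → k ≢ j → transpose i j ⟨$⟩ʳ k ≡ k
  transpose-other {k} k≢i k≢j with k Fin.≟ i
  ... | yes k≡i = contradiction k≡i k≢i
  ... | no  _ with k Fin.≟ j
  ...   | yes k≡j = contradiction k≡j k≢j
  ...   | no  _   = refl

  transpose-preserves : ∀ {C : Set} (g : Fin m → C) → g i ≡ g j →
                        ∀ k → g (transpose i j ⟨$⟩ʳ k) ≡ g k
  transpose-preserves g gi≡gj k with k Fin.≟ i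
  ... | yes refl = sym gi≡gj
  ... | no  _ with k Fin.≟ j
  ...   | yes refl = gi≡gj
  ...   | no  _    = refl

listDistColourable⇒distColourable : ∀ G {k} → ProperlyListDistColourable G k →
                                    ProperDistColourable G k
listDistColourable⇒distColourable G {k} listColourable
  with listColourable (λ _ → upTo k) (λ _ → Unique.upTo⁺ k , length-upTo k)
... | f , f∈ , proper , distinguishing =
  g , (λ u v adj → proper u v adj ∘ g-injective)
    , (λ π aut fix → distinguishing π aut (g-injective ∘ fix))
  where
  g : Fin (N G) → Fin k
  g v = fromℕ< (∈-upTo⁻ (f∈ v))
  g-injective : ∀ {u v} → g u ≡ g v → f u ≡ f v
  g-injective {u} {v} eq = trans (sym (toℕ-fromℕ< (∈-upTo⁻ (f∈ u))))
                                 (trans (cong toℕ eq) (toℕ-fromℕ< (∈-upTo⁻ (f∈ v))))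

module FriendshipGraph (n : ℕ) where

  Leaf : Set
  Leaf = Fin (2 * n)

  leaf : Fin n → Fin 2 → Leaf
  leaf t s = cast (*-comm n 2) (combine t s)

  triangle : Leaf → Fin n
  triangle j = quotient 2 (cast (*-comm 2 n) j)

  side : Leaf → Fin 2
  side j = remainder {n} 2 (cast (*-comm 2 n) j)

  partner : Leaf → Leaf
  partner j = leaf (triangle j) (opposite (side j))

  leaf-triangle-side : ∀ j → leaf (triangle j) (side j) ≡ j
  leaf-triangle-side j =
    trans (cong (cast _) (combine-remQuot {n} 2 (cast _ j))) (cast-involutive (*-comm n 2) (*-comm 2 n) j)

  remQuot-leaf : ∀ t s → remQuot {n} 2 (cast (*-comm 2 n) (leaf t s)) ≡ (t , s)
  remQuot-leaf t s =
    trans (cong (remQuot 2) (cast-involutive (*-comm 2 n) (*-comm n 2) (combine t s))) (remQuot-combine t s)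

  triangle-leaf : ∀ t s → triangle (leaf t s) ≡ t
  triangle-leaf t s = cong proj₁ (remQuot-leaf t s)

  side-leaf : ∀ t s → side (leaf t s) ≡ s
  side-leaf t s = cong proj₂ (remQuot-leaf t s)

  toℕ-triangle : ∀ j → toℕ (triangle j) ≡ toℕ j / 2
  toℕ-triangle j = begin
    toℕ t                           ≡⟨ [2*m+n]/2≡m (toℕ t) (toℕ<n s) ⟨
    (2 * toℕ t + toℕ s) / 2         ≡⟨ cong (_/ 2) (toℕ-combine t s) ⟨
    toℕ (combine t s) / 2           ≡⟨ cong (_/ 2) (toℕ-cast _ (combine t s)) ⟨
    toℕ (leaf t s) / 2              ≡⟨ cong (λ i → toℕ i / 2) (leaf-triangle-side j) ⟩
    toℕ j / 2                       ∎
    where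
    open ≡-Reasoning
    t = triangle j
    s = side j

  triangle-partner : ∀ j → triangle (partner j) ≡ triangle j
  triangle-partner j = triangle-leaf _ _

  side-partner : ∀ j → side (partner j) ≡ opposite (side j)
  side-partner j = side-leaf _ _

  partner-involutive : ∀ j → partner (partner j) ≡ j
  partner-involutive j = begin
    leaf (triangle (partner j)) (opposite (side (partner j)))
      ≡⟨ cong₂ leaf (triangle-partner j)
                    (trans (cong opposite (side-partner j)) (opposite-involutive (side j))) ⟩
    leaf (triangle j) (side j)
      ≡⟨ leaf-triangle-side j ⟩
    j ∎
    where open ≡-Reasoning

  partner-≢ : ∀ j → partner j ≢ j
  partner-≢ j eq = opposite-≢ (side j) (trans (sym (side-partner j)) (cong side eq))

  same-triangle : ∀ {j k} → triangle j ≡ triangle k → k ≡ j ⊎ k ≡ partner j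
  same-triangle {j} {k} tj≡tk with side j Fin.≟ side k
  ... | yes sj≡sk = inj₁ (begin
    k                           ≡⟨ leaf-triangle-side k ⟨
    leaf (triangle k) (side k)  ≡⟨ cong₂ leaf tj≡tk sj≡sk ⟨
    leaf (triangle j) (side j)  ≡⟨ leaf-triangle-side j ⟩
    j                           ∎)
    where open ≡-Reasoning
  ... | no  sj≢sk = inj₂ (begin
    k                           ≡⟨ leaf-triangle-side k ⟨
    leaf (triangle k) (side k)  ≡⟨ cong₂ leaf (sym tj≡tk) (≢⇒≡opposite sj≢sk) ⟩
    partner j                   ∎)
    where open ≡-Reasoning

  adjacent⇔partner : ∀ j k → FAdj n (suc j) (suc k) ⇔ k ≡ partner j
  adjacent⇔partner j k = mk⇔ to from
    where
    to : FAdj n (suc j) (suc k) → k ≡ partner j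
    to (j≢k , j/2≡k/2) with same-triangle (toℕ-injective
                              (trans (toℕ-triangle j) (trans j/2≡k/2 (sym (toℕ-triangle k)))))
    ... | inj₁ k≡j  = contradiction (sym k≡j) j≢k
    ... | inj₂ k≡j′ = k≡j′
    from : k ≡ partner j → FAdj n (suc j) (suc k)
    from refl = partner-≢ j ∘ sym
              , trans (sym (toℕ-triangle j))
                      (trans (cong toℕ (sym (triangle-partner j))) (toℕ-triangle (partner j)))

  lift₀-automorphism : ∀ (ρ : Permutation′ (2 * n)) →
                       (∀ j → ρ ⟨$⟩ʳ partner j ≡ partner (ρ ⟨$⟩ʳ j)) →
                       IsAutomorphism (Friendship n) (lift₀ ρ)
  lift₀-automorphism ρ ρ-partner zero    zero    = mk⇔ id id
  lift₀-automorphism ρ ρ-partner zero    (suc k) = mk⇔ id id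
  lift₀-automorphism ρ ρ-partner (suc j) zero    = mk⇔ id id
  lift₀-automorphism ρ ρ-partner (suc j) (suc k) =
    ⇔-sym (adjacent⇔partner (ρ ⟨$⟩ʳ j) (ρ ⟨$⟩ʳ k))
      ⇔-∘ (ρ-preserves ⇔-∘ adjacent⇔partner j k)
    where
    ρ-preserves : k ≡ partner j ⇔ ρ ⟨$⟩ʳ k ≡ partner (ρ ⟨$⟩ʳ j)
    ρ-preserves = mk⇔ (λ k≡j′ → trans (cong (ρ ⟨$⟩ʳ_) k≡j′) (ρ-partner j))
                      (λ eq → Injection.injective (↔⇒↣ ρ) (trans eq (sym (ρ-partner j))))

  module EdgeSwap {x y : Leaf} (tx≢ty : triangle x ≢ triangle y) where

    σ : Permutation′ (2 * n)
    σ = transpose (partner x) (partner y) ∘ₚ transpose x y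

    private
      apart : ∀ {a b} → triangle a ≡ triangle x → triangle b ≡ triangle y → a ≢ b
      apart ta tb a≡b = tx≢ty (trans (sym ta) (trans (cong triangle a≡b) tb))

      x≢x′ : x ≢ partner x
      x≢x′ = partner-≢ x ∘ sym

      y≢y′ : y ≢ partner y
      y≢y′ = partner-≢ y ∘ sym

    σ-x : σ ⟨$⟩ʳ x ≡ y
    σ-x = trans (cong (transpose x y ⟨$⟩ʳ_)
                      (transpose-other _ _ x≢x′ (apart refl (triangle-partner y))))
                (transpose-matchˡ x y)

    σ-y : σ ⟨$⟩ʳ y ≡ x
    σ-y = trans (cong (transpose x y ⟨$⟩ʳ_)
                      (transpose-other _ _ (apart (triangle-partner x) refl ∘ sym) y≢y′))
                (transpose-matchʳ x y)

    σ-x′ : σ ⟨$⟩ʳ partner x ≡ partner y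
    σ-x′ = trans (cong (transpose x y ⟨$⟩ʳ_) (transpose-matchˡ (partner x) (partner y)))
                 (transpose-other x y (apart refl (triangle-partner y) ∘ sym) (y≢y′ ∘ sym))

    σ-y′ : σ ⟨$⟩ʳ partner y ≡ partner x
    σ-y′ = trans (cong (transpose x y ⟨$⟩ʳ_) (transpose-matchʳ (partner x) (partner y)))
                 (transpose-other x y (x≢x′ ∘ sym) (apart (triangle-partner x) refl))

    σ-other : ∀ {k} → triangle x ≢ triangle k → triangle y ≢ triangle k → σ ⟨$⟩ʳ k ≡ k
    σ-other {k} tx≢tk ty≢tk =
      trans (cong (transpose x y ⟨$⟩ʳ_) (transpose-other _ _ (away-from (triangle-partner x) tx≢tk)
                                                              (away-from (triangle-partner y) ty≢tk)))
            (transpose-other x y (away-from refl tx≢tk) (away-from refl ty≢tk))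
      where
      away-from : ∀ {a b} → triangle a ≡ triangle b → triangle b ≢ triangle k → k ≢ a
      away-from ta≡tb tb≢tk k≡a = tb≢tk (trans (sym ta≡tb) (cong triangle (sym k≡a)))

    edge-to-edge : ∀ {a b k} → σ ⟨$⟩ʳ a ≡ b → σ ⟨$⟩ʳ partner a ≡ partner b →
                   k ≡ a ⊎ k ≡ partner a → σ ⟨$⟩ʳ partner k ≡ partner (σ ⟨$⟩ʳ k)
    edge-to-edge σa σa′ (inj₁ refl) = trans σa′ (cong partner (sym σa))
    edge-to-edge {a} {b} σa σa′ (inj₂ refl) = begin
      σ ⟨$⟩ʳ partner (partner a)  ≡⟨ cong (σ ⟨$⟩ʳ_) (partner-involutive a) ⟩
      σ ⟨$⟩ʳ a                    ≡⟨ σa ⟩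
      b                           ≡⟨ partner-involutive b ⟨
      partner (partner b)         ≡⟨ cong partner σa′ ⟨
      partner (σ ⟨$⟩ʳ partner a)  ∎
      where open ≡-Reasoning

    σ-partner : ∀ k → σ ⟨$⟩ʳ partner k ≡ partner (σ ⟨$⟩ʳ k)
    σ-partner k with triangle x Fin.≟ triangle k | triangle y Fin.≟ triangle k
    ... | yes tx≡tk | _         = edge-to-edge σ-x σ-x′ (same-triangle tx≡tk)
    ... | no  _     | yes ty≡tk = edge-to-edge σ-y σ-y′ (same-triangle ty≡tk)
    ... | no  tx≢tk | no  ty≢tk =
      trans (σ-other (tx≢tk ∘ (λ e → trans e (triangle-partner k)))
                     (ty≢tk ∘ (λ e → trans e (triangle-partner k))))
            (cong partner (sym (σ-other tx≢tk ty≢tk)))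

  leafPair : ∀ {C : Set} → (Leaf → C) → Leaf → C × C
  leafPair c j = c j , c (partner j)

  leafPair-partner : ∀ {C : Set} (c : Leaf → C) j → leafPair c (partner j) ≡ swap (leafPair c j)
  leafPair-partner c j = cong (c (partner j) ,_) (cong c (partner-involutive j))

  SeparatesTriangles : ∀ {C : Set} → (Leaf → C) → Set
  SeparatesTriangles c = ∀ {j k} → leafPair c j ≡ leafPair c k → triangle j ≡ triangle k

  separates-sortPair : ∀ {c : Leaf → ℕ} → SeparatesTriangles c → ∀ {j k} →
                       sortPair (leafPair c j) ≡ sortPair (leafPair c k) → triangle j ≡ triangle k
  separates-sortPair {c} separates {j} {k} eq with sortPair≡⇒≡⊎≡swap eq
  ... | inj₁ same    = separates same
  ... | inj₂ swapped = trans (separates (trans swapped (sym (leafPair-partner c k)))) (triangle-partner k)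

  distinguishing⇒separates : ∀ {C : Set} {f : Fin (suc (2 * n)) → C} →
                             IsDistinguishing (Friendship n) f → SeparatesTriangles (f ∘ suc)
  distinguishing⇒separates {f = f} distinguishing {x} {y} same-colours with triangle x Fin.≟ triangle y
  ... | yes tx≡ty = tx≡ty
  ... | no  tx≢ty = contradiction σx≡x (tx≢ty ∘ cong triangle ∘ sym ∘ trans (sym σ-x))
    where
    open EdgeSwap tx≢ty
    σ-colours : ∀ v → f (lift₀ σ ⟨$⟩ʳ v) ≡ f v
    σ-colours zero    = refl
    σ-colours (suc k) =
      trans (transpose-preserves x y (f ∘ suc) (,-injectiveˡ same-colours) _)
            (transpose-preserves (partner x) (partner y) (f ∘ suc) (,-injectiveʳ same-colours) k)
    σx≡x : σ ⟨$⟩ʳ x ≡ x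
    σx≡x = suc-injective
             (distinguishing (lift₀ σ) (lift₀-automorphism σ σ-partner) σ-colours (suc x))

  separates⇒distinguishing : ∀ {C : Set} {f : Fin (suc (2 * n)) → C} → IsProper (Friendship n) f →
                             SeparatesTriangles (f ∘ suc) → IsDistinguishing (Friendship n) f
  separates⇒distinguishing {f = f} proper separates π automorphism preserves = fixes
    where
    π-centre : π ⟨$⟩ʳ zero ≡ zero
    π-centre with π ⟨$⟩ʳ zero in eq
    ... | zero  = refl
    ... | suc k = contradiction (trans (cong f (sym eq)) (preserves zero)) (proper (suc k) zero tt)
    ρ : Permutation′ (2 * n)
    ρ = remove zero π
    π-suc : ∀ j → π ⟨$⟩ʳ suc j ≡ suc (ρ ⟨$⟩ʳ j)
    π-suc j = sym (lift₀-remove π π-centre (suc j))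
    ρ-colour : ∀ j → f (suc (ρ ⟨$⟩ʳ j)) ≡ f (suc j)
    ρ-colour j = trans (cong f (sym (π-suc j))) (preserves (suc j))
    ρ-partner : ∀ j → ρ ⟨$⟩ʳ partner j ≡ partner (ρ ⟨$⟩ʳ j)
    ρ-partner j = Equivalence.to (adjacent⇔partner _ _)
      (subst₂ (FAdj n) (π-suc j) (π-suc (partner j))
        (Equivalence.to (automorphism (suc j) (suc (partner j)))
                        (Equivalence.from (adjacent⇔partner j _) refl)))
    ρ-fixes : ∀ j → ρ ⟨$⟩ʳ j ≡ j
    ρ-fixes j with same-triangle (separates (cong₂ _,_ (ρ-colour j)
                     (trans (cong (f ∘ suc) (sym (ρ-partner j))) (ρ-colour (partner j)))))
    ... | inj₁ j≡ρj  = sym j≡ρj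
    ... | inj₂ j≡ρj′ = contradiction (ρ-colour j) (proper (suc (ρ ⟨$⟩ʳ j)) (suc j) ρj-adjacent-j)
      where
      ρj-adjacent-j : FAdj n (suc (ρ ⟨$⟩ʳ j)) (suc j)
      ρj-adjacent-j = Equivalence.from (adjacent⇔partner _ _) j≡ρj′
    fixes : ∀ v → π ⟨$⟩ʳ v ≡ v
    fixes zero    = π-centre
    fixes (suc j) = trans (π-suc j) (cong suc (ρ-fixes j))

  colours-lower-bound : ∀ {r} → ProperDistColourable (Friendship n) (suc r) → n ≤ r C 2
  colours-lower-bound {r} (f , proper , distinguishing) = distinctPairs-bound r P P-below P-separated
    where
    -- leaf colours renumbered within the r colours different from the centre's
    c : Leaf → ℕ
    c j = toℕ (punchOut (proper zero (suc j) tt))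
    c-injective : ∀ {j k} → c j ≡ c k → f (suc j) ≡ f (suc k)
    c-injective {j} {k} eq =
      punchOut-injective (proper zero (suc j) tt) (proper zero (suc k) tt) (toℕ-injective eq)
    separated : SeparatesTriangles c
    separated eq = distinguishing⇒separates distinguishing
                     (cong₂ _,_ (c-injective (,-injectiveˡ eq)) (c-injective (,-injectiveʳ eq)))
    P : Fin n → ℕ × ℕ
    P t = leafPair c (leaf t zero)
    P-below : ∀ t → proj₁ (P t) < r × proj₂ (P t) < r × proj₁ (P t) ≢ proj₂ (P t)
    P-below t = toℕ<n _ , toℕ<n _ ,
      λ eq → proper (suc (leaf t zero)) _ (Equivalence.from (adjacent⇔partner _ _) refl) (c-injective eq)
    P-separated : Injective _≡_ _≡_ (sortPair ∘ P)
    P-separated {t} {t′} eq =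
      trans (sym (triangle-leaf t zero)) (trans (separates-sortPair separated eq) (triangle-leaf t′ zero))

  availableColours : ListAssignment (Friendship n) → ℕ → Leaf → List ℕ
  availableColours L c j = without _≟_ c (L (suc j))

  availableColours-large : ∀ {L m} → IsKAssignment (Friendship n) L (suc m) →
                           ∀ c j → DistinctAtLeast m (availableColours L c j)
  availableColours-large {L} K c j with !L , |L|≡1+m ← K (suc j) =
    Unique.filter⁺ (λ y → ¬? (y ≟ c)) !L ,
    s≤s⁻¹ (subst (_≤ suc (length (availableColours L c j))) |L|≡1+m (length-without _≟_ c !L))

  listColourable : ∀ {m} → n ≤ m C 2 → ProperlyListDistColourable (Friendship n) (suc m)
  listColourable {m} n≤mC2 L K
    with c , c∈L₀ ← head∈ (proj₂ (K zero))
    with P , P-from , P-injective ← chooseDistinctPairs m n≤mC2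
           (λ t → availableColours L c (leaf t zero)) (λ t → availableColours L c (leaf t (suc zero)))
           (λ _ → availableColours-large K c _) (λ _ → availableColours-large K c _)
    = f , f∈L , proper , separates⇒distinguishing proper separated
    where
    f : Fin (suc (2 * n)) → ℕ
    f zero    = c
    f (suc j) = pick (P (triangle j)) (side j)
    f-available : ∀ j → f (suc j) ∈ availableColours L c j
    f-available j =
      subst (λ i → f (suc j) ∈ availableColours L c i) (leaf-triangle-side j)
            (pick-∈ {A = availableColours L c ∘ leaf (triangle j)} (P-from (triangle j)) (side j))
    f-partner : ∀ j → f (suc (partner j)) ≡ pick (P (triangle j)) (opposite (side j))
    f-partner j = cong₂ (pick ∘ P) (triangle-partner j) (side-partner j)
    f∈L : ∀ v → f v ∈ L v
    f∈L zero    = c∈L₀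
    f∈L (suc j) = proj₁ (∈-without⁻ _≟_ (L (suc j)) (f-available j))
    proper : IsProper (Friendship n) f
    proper zero    (suc k) _ = proj₂ (∈-without⁻ _≟_ (L (suc k)) (f-available k)) ∘ sym
    proper (suc j) zero    _ = proj₂ (∈-without⁻ _≟_ (L (suc j)) (f-available j))
    proper (suc j) (suc k) adj with refl ← Equivalence.to (adjacent⇔partner j k) adj =
      λ eq → pick-opposite-≢ (proj₂ (proj₂ (P-from (triangle j)))) (side j) (trans eq (f-partner j))
    sortPair-leafPair : ∀ j → sortPair (leafPair (f ∘ suc) j) ≡ sortPair (P (triangle j))
    sortPair-leafPair j =
      trans (cong (λ b → sortPair (f (suc j) , b)) (f-partner j)) (sortPair-pick _ (side j))
    separated : SeparatesTriangles (f ∘ suc)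
    separated {j} {k} eq =
      P-injective (trans (sym (sortPair-leafPair j)) (trans (cong sortPair eq) (sortPair-leafPair k)))

mainTheorem15 : (n : ℕ) → 2 ≤ n → (m : ℕ) → IsCeilHalfOnePlusSqrt8nPlus1 n m →
    ChiDL≡ (Friendship n) (1 + m) × ChiD≡ (Friendship n) (1 + m)
mainTheorem15 n 2≤n m isCeil with isCeil⇒C2-bounds (≤-trans (n≤1+n 1) 2≤n) isCeil
... | k , refl , kC2<n , n≤[1+k]C2 = (listColourable n≤[1+k]C2 , listMinimal) , (colourable , minimal)
  where
  open FriendshipGraph n
  colourable : ProperDistColourable (Friendship n) (2 + k)
  colourable = listDistColourable⇒distColourable _ (listColourable n≤[1+k]C2)
  minimal : ∀ r → ProperDistColourable (Friendship n) r → 2 + k ≤ r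
  minimal zero    (f , _) with () ← f zero
  minimal (suc r) colourable′ = s≤s (≰⇒> λ r≤k →
    <⇒≱ kC2<n (≤-trans (colours-lower-bound colourable′) (C2-mono-≤ r≤k)))
  listMinimal : ∀ r → ProperlyListDistColourable (Friendship n) r → 2 + k ≤ r
  listMinimal r = minimal r ∘ listDistColourable⇒distColourable _
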